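{- The cohomology $H^1(G,M)\cong\ker d^1/\mathrm{im}\,d^0$ is a $9$-dimensional $\mathbb{F}_3$-vector space, with basis the classes of the pairs $(a,b)\in M^2$: $(f^2-e^2,\,0)$; $(ef^2-e^2f,\,0)$; $(e^2+e^2f+e^2f^2,\,0)$; $(e^2f-e^2f^2,\ ef-ef^2-e^2f+e^2f^2)$; $(0,\ 1-ef-ef^2-e^2f-e^2f^2)$; $(0,\ f+ef+e^2f)$; $(0,\ f^2+ef^2+e^2f^2)$; $(0,\ e+ef+ef^2)$; $(0,\ e^2+e^2f+e^2f^2)$.
   Context: Let $\zeta$ be a primitive cube root of unity, $K=\mathbb{Q}(\zeta)$, $L=K(\sqrt[3]{\zeta},\sqrt[3]{1-\zeta^{ -1}})$ (the splitting field of $1-(1-x^3)^3$), and $G=\mathrm{Gal}(L/K)\cong(\mathbb{Z}/3)^2$, generated by $\sigma,\tau$ with $\sigma(\sqrt[3]{\zeta})=\zeta\sqrt[3]{\zeta}$, $\sigma(\sqrt[3]{1-\zeta^{ -1}})=\sqrt[3]{1-\zeta^{ -1}}$, $\tau(\sqrt[3]{\zeta})=\sqrt[3]{\zeta}$, $\tau(\sqrt[3]{1-\zeta^{ -1}})=\zeta\sqrt[3]{1-\zeta^{ -1}}$. Let $M=\mathbb{F}_3[e,f]/(e^3-1,f^3-1)$, which is the Galois module $H_1(U,Y;\mathbb{F}_3)$ (étale relative homology of the affine Fermat curve $U: x^3+y^3=1$ relative to $Y:xy=0$, identified with $M$ via $W\mapsto W\beta$ for Anderson's generator $\beta$), on which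 $G$ acts by $\sigma\cdot m=B_\sigma m$, $\tau\cdot m=B_\tau m$ with $B_\sigma=1-(e+f)(1-e)(1-f)$ and $B_\tau=1+(e+f)-(e^2+ef+f^2)+e^2f^2$. Write $N_\sigma=1+\sigma+\sigma^2$, $N_\tau=1+\tau+\tau^2$. The cohomology of $G$ is computed by the complex $M\xrightarrow{d^0}M^2\xrightarrow{d^1}M^3\xrightarrow{d^2}M^4$ with $d^0(m)=((1-\sigma)m,(1-\tau)m)$, $d^1(a,b)=(N_\sigma a,(1-\tau)a-(1-\sigma)b,N_\tau b)$, $d^2(x,y,z)=((1-\sigma)x,(1-\tau)x-N_\sigma y,N_\tau y+(1-\sigma)z,(1-\tau)z)$. -}

module Defs where

import Data.Nat
open import Data.Fin using (Fin; zero; suc)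
open import Data.Product using (_×_; _,_)
open import Relation.Binary.PropositionalEquality using (_≡_)

data F3 : Set where
  0# 1# 2# : F3

infixl 6 _+₃_ _-₃_
infixl 7 _*₃_

_+₃_ : F3 → F3 → F3
0# +₃ y  = y
1# +₃ 0# = 1#
1# +₃ 1# = 2#
1# +₃ 2# = 0#
2# +₃ 0# = 2#
2# +₃ 1# = 0#
2# +₃ 2# = 1#

-₃_ : F3 → F3
-₃ 0# = 0#
-₃ 1# = 2#
-₃ 2# = 1#

_-₃_ : F3 → F3 → F3
x -₃ y = x +₃ (-₃ y)

_*₃_ : F3 → F3 → F3
0# *₃ y  = 0#
1# *₃ y  = y
2# *₃ y  = -₃ y

_⊖_ : Fin 3 → Fin 3 → Fin 3
i ⊖ zero = i
zero ⊖ suc zero = suc (suc zero)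
suc zero ⊖ suc zero = zero
suc (suc zero) ⊖ suc zero = suc zero
zero ⊖ suc (suc zero) = suc zero
suc zero ⊖ suc (suc zero) = suc (suc zero)
suc (suc zero) ⊖ suc (suc zero) = zero

sum3 : (Fin 3 → F3) → F3
sum3 g = g zero +₃ g (suc zero) +₃ g (suc (suc zero))

-- M = F₃[e,f]/(e³-1,f³-1) = F₃[Z/3 × Z/3]:
-- an element is its coefficient function, x i j = coefficient of e^i f^j.

M : Set
M = Fin 3 → Fin 3 → F3

_≈_ : M → M → Set
x ≈ y = ∀ i j → x i j ≡ y i j

infixl 6 _+_ _-_
infixl 7 _*_ _·_

_+_ : M → M → M
(x + y) i j = x i j +₃ y i j

_-_ : M → M → M
(x - y) i j = x i j -₃ y i j

_·_ : F3 → M → M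
(c · x) i j = c *₃ x i j

_*_ : M → M → M
(x * y) i j = sum3 λ k → sum3 λ l → x k l *₃ y (i ⊖ k) (j ⊖ l)

𝟘 : M
𝟘 _ _ = 0#

δ : Fin 3 → Fin 3 → F3
δ zero zero = 1#
δ (suc zero) (suc zero) = 1#
δ (suc (suc zero)) (suc (suc zero)) = 1#
δ _ _ = 0#

mono : Fin 3 → Fin 3 → M
mono i j k l = δ i k *₃ δ j l

𝟙 e f : M
𝟙 = mono zero zero
e = mono (suc zero) zero
f = mono zero (suc zero)

Bσ : M
Bσ = 𝟙 - (e + f) * (𝟙 - e) * (𝟙 - f)

Bτ : M
Bτ = 𝟙 + (e + f) - (e * e + e * f + f * f) + e * e * f * f

σ· τ· : M → M
σ· m = Bσ * m
τ· m = Bτ * m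

1-σ 1-τ Nσ Nτ : M → M
1-σ m = m - σ· m
1-τ m = m - τ· m
Nσ m = m + σ· m + σ· (σ· m)
Nτ m = m + τ· m + τ· (τ· m)

M² M³ : Set
M² = M × M
M³ = M × M × M

_≈²_ : M² → M² → Set
(a , b) ≈² (a' , b') = (a ≈ a') × (b ≈ b')

_≈³_ : M³ → M³ → Set
(x , y , z) ≈³ (x' , y' , z') = (x ≈ x') × (y ≈ y') × (z ≈ z')

_+²_ : M² → M² → M²
(a , b) +² (a' , b') = (a + a') , (b + b')

_·²_ : F3 → M² → M²
c ·² (a , b) = (c · a) , (c · b)

𝟘² : M²
𝟘² = 𝟘 , 𝟘

𝟘³ : M³
𝟘³ = 𝟘 , 𝟘 , 𝟘

d⁰ : M → M²
d⁰ m = 1-σ m , 1-τ m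

d¹ : M² → M³
d¹ (a , b) = Nσ a , (1-τ a - 1-σ b) , Nτ b

basis : Fin 9 → M²
basis zero = (f * f - e * e) , 𝟘
basis (suc zero) = (e * f * f - e * e * f) , 𝟘
basis (suc (suc zero)) = (e * e + e * e * f + e * e * f * f) , 𝟘
basis (suc (suc (suc zero))) =
  (e * e * f - e * e * f * f) , (e * f - e * f * f - e * e * f + e * e * f * f)
basis (suc (suc (suc (suc zero)))) =
  𝟘 , (𝟙 - e * f - e * f * f - e * e * f - e * e * f * f)
basis (suc (suc (suc (suc (suc zero))))) = 𝟘 , (f + e * f + e * e * f)
basis (suc (suc (suc (suc (suc (suc zero)))))) = 𝟘 , (f * f + e * f * f + e * e * f * f)
basis (suc (suc (suc (suc (suc (suc (suc zero))))))) = 𝟘 , (e + e * f + e * f * f)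
basis (suc (suc (suc (suc (suc (suc (suc (suc zero)))))))) =
  𝟘 , (e * e + e * e * f + e * e * f * f)

combo : (Fin 9 → F3) → M²
combo c = go 9 (λ k → k)
  where
  go : (n : Data.Nat.ℕ) → (Fin n → Fin 9) → M²
  go Data.Nat.zero ι = 𝟘²
  go (Data.Nat.suc n) ι = (c (ι zero) ·² basis (ι zero)) +² go n (λ k → ι (suc k))

{-# OPTIONS --safe #-}
module Submission where

-- Everything in sight is F₃-linear, so the theorem reduces to identities between explicit
-- matrices.  Nine linear forms φₖ on M² that are dual to the basis and vanish on coboundaries
-- give independence; together with a primitive ψ and a matrix P such that every x ∈ M²
-- satisfies  x = Σₖ φₖ(x) basisₖ + d⁰(ψ x) + P(d¹ x),  they show that every cocycle is a
-- combination of the basis plus a coboundary.  Such an identity of linear maps is checked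
-- once, by computation, on the generic cochain whose coordinates are indeterminates
-- (linear forms), and is then evaluated at an arbitrary cochain.

open import Defs
open import Data.Fin using (Fin; zero; suc; combine; remQuot; _↑ˡ_; _↑ʳ_)
open import Data.Fin.Patterns using (0F; 1F; 2F; 3F; 4F; 5F; 6F; 7F; 8F)
open import Data.Fin.Properties using (remQuot-combine)
open import Data.Nat using (ℕ; zero; suc)
open import Data.Product using (_×_; Σ; _,_; proj₁; proj₂; uncurry)
open import Data.Vec using (Vec; []; _∷_; lookup; tabulate; map; zipWith; replicate; _++_)
open import Data.Vec.Properties
  using (lookup∘tabulate; tabulate∘lookup; tabulate-∘; tabulate-cong; lookup-map; lookup-replicate;
         lookup-++ˡ; lookup-++ʳ; ++-injectiveˡ; ++-injectiveʳ; map-∘; map-cong; map-replicate; map-++)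
open import Function using (id; _∘_)
open import Relation.Binary.PropositionalEquality
  using (_≡_; refl; sym; trans; cong; cong₂; module ≡-Reasoning)
open ≡-Reasoning

private variable
  k m n : ℕ
  A : Set

+-identityʳ : ∀ x → x +₃ 0# ≡ x
+-identityʳ 0# = refl
+-identityʳ 1# = refl
+-identityʳ 2# = refl

+-comm : ∀ x y → x +₃ y ≡ y +₃ x
+-comm 0# y  = sym (+-identityʳ y)
+-comm 1# 0# = refl
+-comm 1# 1# = refl
+-comm 1# 2# = refl
+-comm 2# 0# = refl
+-comm 2# 1# = refl
+-comm 2# 2# = refl

+-assoc : ∀ x y z → x +₃ y +₃ z ≡ x +₃ (y +₃ z)
+-assoc 0# y  z  = refl
+-assoc 1# 0# z  = refl
+-assoc 2# 0# z  = refl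
+-assoc 1# 1# 0# = refl
+-assoc 1# 1# 1# = refl
+-assoc 1# 1# 2# = refl
+-assoc 1# 2# 0# = refl
+-assoc 1# 2# 1# = refl
+-assoc 1# 2# 2# = refl
+-assoc 2# 1# 0# = refl
+-assoc 2# 1# 1# = refl
+-assoc 2# 1# 2# = refl
+-assoc 2# 2# 0# = refl
+-assoc 2# 2# 1# = refl
+-assoc 2# 2# 2# = refl

+-interchange : ∀ x y u v → (x +₃ y) +₃ (u +₃ v) ≡ (x +₃ u) +₃ (y +₃ v)
+-interchange x y u v = begin
  (x +₃ y) +₃ (u +₃ v)   ≡⟨ +-assoc x y (u +₃ v) ⟩
  x +₃ (y +₃ (u +₃ v))   ≡⟨ cong (x +₃_) (sym (+-assoc y u v)) ⟩
  x +₃ ((y +₃ u) +₃ v)   ≡⟨ cong (λ w → x +₃ (w +₃ v)) (+-comm y u) ⟩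
  x +₃ ((u +₃ y) +₃ v)   ≡⟨ cong (x +₃_) (+-assoc u y v) ⟩
  x +₃ (u +₃ (y +₃ v))   ≡⟨ sym (+-assoc x u (y +₃ v)) ⟩
  (x +₃ u) +₃ (y +₃ v)   ∎

*-zeroʳ : ∀ x → x *₃ 0# ≡ 0#
*-zeroʳ 0# = refl
*-zeroʳ 1# = refl
*-zeroʳ 2# = refl

*-comm : ∀ x y → x *₃ y ≡ y *₃ x
*-comm 0# y  = sym (*-zeroʳ y)
*-comm 1# 0# = refl
*-comm 1# 1# = refl
*-comm 1# 2# = refl
*-comm 2# 0# = refl
*-comm 2# 1# = refl
*-comm 2# 2# = refl

*-assoc : ∀ x y z → x *₃ y *₃ z ≡ x *₃ (y *₃ z)
*-assoc 0# y  z  = refl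
*-assoc 1# y  z  = refl
*-assoc 2# 0# z  = refl
*-assoc 2# 1# z  = refl
*-assoc 2# 2# 0# = refl
*-assoc 2# 2# 1# = refl
*-assoc 2# 2# 2# = refl

*-distribˡ-+ : ∀ x y z → x *₃ (y +₃ z) ≡ x *₃ y +₃ x *₃ z
*-distribˡ-+ 0# y  z  = refl
*-distribˡ-+ 1# y  z  = refl
*-distribˡ-+ 2# 0# z  = refl
*-distribˡ-+ 2# 1# 0# = refl
*-distribˡ-+ 2# 1# 1# = refl
*-distribˡ-+ 2# 1# 2# = refl
*-distribˡ-+ 2# 2# 0# = refl
*-distribˡ-+ 2# 2# 1# = refl
*-distribˡ-+ 2# 2# 2# = refl

*-distribʳ-+ : ∀ x y z → (y +₃ z) *₃ x ≡ y *₃ x +₃ z *₃ x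
*-distribʳ-+ x y z = begin
  (y +₃ z) *₃ x      ≡⟨ *-comm (y +₃ z) x ⟩
  x *₃ (y +₃ z)      ≡⟨ *-distribˡ-+ x y z ⟩
  x *₃ y +₃ x *₃ z   ≡⟨ cong₂ _+₃_ (*-comm x y) (*-comm x z) ⟩
  y *₃ x +₃ z *₃ x   ∎

-- Linear forms in n indeterminates, given by their coefficient vectors.
Form : ℕ → Set
Form = Vec F3

infixl 6 _⊕_ _⊝_ _⊞_
infixr 7 _⊛_
infixl 7 _∙_

_⊕_ : Form n → Form n → Form n
_⊕_ = zipWith _+₃_

_⊛_ : F3 → Form n → Form n
c ⊛ u = map (c *₃_) u

_⊝_ : Form n → Form n → Form n
u ⊝ v = u ⊕ 2# ⊛ v

0ᶠ : Form n
0ᶠ = replicate _ 0#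

var : Fin n → Form n
var zero    = 1# ∷ 0ᶠ
var (suc k) = 0# ∷ var k

lin : Vec F3 m → Vec (Form n) m → Form n
lin []       []       = 0ᶠ
lin (p ∷ ps) (u ∷ us) = p ⊛ u ⊕ lin ps us

⟦_⟧_ : Form n → Vec F3 n → F3
⟦ [] ⟧    []      = 0#
⟦ a ∷ u ⟧ (r ∷ ρ) = a *₃ r +₃ ⟦ u ⟧ ρ

_∙_ : Vec (Form m) k → Vec (Form n) m → Vec (Form n) k
P ∙ Q = map (λ p → lin p Q) P

_⊞_ : Vec (Form n) m → Vec (Form n) m → Vec (Form n) m
_⊞_ = zipWith _⊕_

⟦_⟧*_ : Vec (Form n) m → Vec F3 n → Vec F3 m
⟦ P ⟧* ρ = map (λ u → ⟦ u ⟧ ρ) P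

⟦⟧-⊕ : (u v : Form n) (ρ : Vec F3 n) → ⟦ u ⊕ v ⟧ ρ ≡ ⟦ u ⟧ ρ +₃ ⟦ v ⟧ ρ
⟦⟧-⊕ []      []      []      = refl
⟦⟧-⊕ (a ∷ u) (b ∷ v) (r ∷ ρ) = begin
  (a +₃ b) *₃ r +₃ ⟦ u ⊕ v ⟧ ρ                ≡⟨ cong₂ _+₃_ (*-distribʳ-+ r a b) (⟦⟧-⊕ u v ρ) ⟩
  (a *₃ r +₃ b *₃ r) +₃ (⟦ u ⟧ ρ +₃ ⟦ v ⟧ ρ)   ≡⟨ +-interchange (a *₃ r) (b *₃ r) (⟦ u ⟧ ρ) (⟦ v ⟧ ρ) ⟩
  (a *₃ r +₃ ⟦ u ⟧ ρ) +₃ (b *₃ r +₃ ⟦ v ⟧ ρ)   ∎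

⟦⟧-⊛ : ∀ c (u : Form n) (ρ : Vec F3 n) → ⟦ c ⊛ u ⟧ ρ ≡ c *₃ ⟦ u ⟧ ρ
⟦⟧-⊛ c []      []      = sym (*-zeroʳ c)
⟦⟧-⊛ c (a ∷ u) (r ∷ ρ) = begin
  c *₃ a *₃ r +₃ ⟦ c ⊛ u ⟧ ρ      ≡⟨ cong₂ _+₃_ (*-assoc c a r) (⟦⟧-⊛ c u ρ) ⟩
  c *₃ (a *₃ r) +₃ c *₃ ⟦ u ⟧ ρ   ≡⟨ sym (*-distribˡ-+ c (a *₃ r) (⟦ u ⟧ ρ)) ⟩
  c *₃ (a *₃ r +₃ ⟦ u ⟧ ρ)        ∎

-- 2# *₃ y reduces to -₃ y, which is why _⊝_ scales by 2#.
⟦⟧-⊝ : (u v : Form n) (ρ : Vec F3 n) → ⟦ u ⊝ v ⟧ ρ ≡ ⟦ u ⟧ ρ -₃ ⟦ v ⟧ ρ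
⟦⟧-⊝ u v ρ = trans (⟦⟧-⊕ u (2# ⊛ v) ρ) (cong (⟦ u ⟧ ρ +₃_) (⟦⟧-⊛ 2# v ρ))

⟦⟧-0ᶠ : (ρ : Vec F3 n) → ⟦ 0ᶠ ⟧ ρ ≡ 0#
⟦⟧-0ᶠ []      = refl
⟦⟧-0ᶠ (r ∷ ρ) = ⟦⟧-0ᶠ ρ

⟦⟧-var : (k : Fin n) (ρ : Vec F3 n) → ⟦ var k ⟧ ρ ≡ lookup ρ k
⟦⟧-var zero    (r ∷ ρ) = trans (cong (r +₃_) (⟦⟧-0ᶠ ρ)) (+-identityʳ r)
⟦⟧-var (suc k) (r ∷ ρ) = ⟦⟧-var k ρ

⟦⟧-lin : (p : Vec F3 m) (us : Vec (Form n) m) (ρ : Vec F3 n) → ⟦ lin p us ⟧ ρ ≡ ⟦ p ⟧ (⟦ us ⟧* ρ)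
⟦⟧-lin []       []       ρ = ⟦⟧-0ᶠ ρ
⟦⟧-lin (p ∷ ps) (u ∷ us) ρ = begin
  ⟦ p ⊛ u ⊕ lin ps us ⟧ ρ              ≡⟨ ⟦⟧-⊕ (p ⊛ u) (lin ps us) ρ ⟩
  ⟦ p ⊛ u ⟧ ρ +₃ ⟦ lin ps us ⟧ ρ       ≡⟨ cong₂ _+₃_ (⟦⟧-⊛ p u ρ) (⟦⟧-lin ps us ρ) ⟩
  p *₃ ⟦ u ⟧ ρ +₃ ⟦ ps ⟧ (⟦ us ⟧* ρ)   ∎

⟦⟧-at-0ᶠ : (u : Form n) → ⟦ u ⟧ 0ᶠ ≡ 0#
⟦⟧-at-0ᶠ []      = refl
⟦⟧-at-0ᶠ (a ∷ u) = cong₂ _+₃_ (*-zeroʳ a) (⟦⟧-at-0ᶠ u)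

⊕-identityʳ : (u : Form n) → u ⊕ 0ᶠ ≡ u
⊕-identityʳ []      = refl
⊕-identityʳ (a ∷ u) = cong₂ _∷_ (+-identityʳ a) (⊕-identityʳ u)

⟦⟧*-∙ : (P : Vec (Form m) k) (Q : Vec (Form n) m) (ρ : Vec F3 n) → ⟦ P ∙ Q ⟧* ρ ≡ ⟦ P ⟧* (⟦ Q ⟧* ρ)
⟦⟧*-∙ P Q ρ = trans (sym (map-∘ (⟦_⟧ ρ) (λ p → lin p Q) P)) (map-cong (λ p → ⟦⟧-lin p Q ρ) P)

⟦⟧*-⊞ : (P Q : Vec (Form n) m) (ρ : Vec F3 n) → ⟦ P ⊞ Q ⟧* ρ ≡ ⟦ P ⟧* ρ ⊕ ⟦ Q ⟧* ρ
⟦⟧*-⊞ []      []      ρ = refl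
⟦⟧*-⊞ (u ∷ P) (v ∷ Q) ρ = cong₂ _∷_ (⟦⟧-⊕ u v ρ) (⟦⟧*-⊞ P Q ρ)

⟦⟧*-at-0ᶠ : (P : Vec (Form n) m) → ⟦ P ⟧* 0ᶠ ≡ 0ᶠ
⟦⟧*-at-0ᶠ []      = refl
⟦⟧*-at-0ᶠ (u ∷ P) = cong₂ _∷_ (⟦⟧-at-0ᶠ u) (⟦⟧*-at-0ᶠ P)

⟦⟧*-replicate-0ᶠ : (ρ : Vec F3 n) → ⟦ replicate m 0ᶠ ⟧* ρ ≡ 0ᶠ
⟦⟧*-replicate-0ᶠ {m = m} ρ = trans (map-replicate (⟦_⟧ ρ) 0ᶠ m) (cong (replicate m) (⟦⟧-0ᶠ ρ))

⟦⟧*-identity : (ρ : Vec F3 n) → ⟦ tabulate var ⟧* ρ ≡ ρ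
⟦⟧*-identity ρ = begin
  map (⟦_⟧ ρ) (tabulate var)   ≡⟨ sym (tabulate-∘ (⟦_⟧ ρ) var) ⟩
  tabulate (λ k → ⟦ var k ⟧ ρ) ≡⟨ tabulate-cong (λ k → ⟦⟧-var k ρ) ⟩
  tabulate (lookup ρ)          ≡⟨ tabulate∘lookup ρ ⟩
  ρ                            ∎

Grid : Set → Set
Grid A = Fin 3 → Fin 3 → A

-- The entry (i , j) of a grid sits at position combine i j = 3 i + j.
flatten : Grid A → Vec A 9
flatten g = tabulate (uncurry g ∘ remQuot {3} 3)

unflatten : Vec A 9 → Grid A
unflatten v i j = lookup v (combine i j)

flatten² : Grid A × Grid A → Vec A 18
flatten² (a , b) = flatten a ++ flatten b

flatten³ : Grid A × Grid A × Grid A → Vec A 27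
flatten³ (x , y , z) = flatten x ++ flatten² (y , z)

lookup-flatten : (g : Grid A) (i j : Fin 3) → lookup (flatten g) (combine i j) ≡ g i j
lookup-flatten g i j =
  trans (lookup∘tabulate (uncurry g ∘ remQuot {3} 3) (combine i j)) (cong (uncurry g) (remQuot-combine i j))

flatten-cong : (x y : M) → x ≈ y → flatten x ≡ flatten y
flatten-cong x y x≈y = tabulate-cong λ v → x≈y (proj₁ (remQuot {3} 3 v)) (proj₂ (remQuot {3} 3 v))

flatten-injective : (x y : M) → flatten x ≡ flatten y → x ≈ y
flatten-injective x y eq i j = begin
  x i j                              ≡⟨ sym (lookup-flatten x i j) ⟩
  lookup (flatten x) (combine i j)   ≡⟨ cong (λ v → lookup v (combine i j)) eq ⟩
  lookup (flatten y) (combine i j)   ≡⟨ lookup-flatten y i j ⟩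
  y i j                              ∎

flatten²-cong : (x y : M²) → x ≈² y → flatten² x ≡ flatten² y
flatten²-cong (a , b) (a′ , b′) (a≈a′ , b≈b′) = cong₂ _++_ (flatten-cong a a′ a≈a′) (flatten-cong b b′ b≈b′)

flatten³-cong : (x y : M³) → x ≈³ y → flatten³ x ≡ flatten³ y
flatten³-cong (x , yz) (x′ , yz′) (x≈x′ , yz≈yz′) =
  cong₂ _++_ (flatten-cong x x′ x≈x′) (flatten²-cong yz yz′ yz≈yz′)

flatten²-injective : (x y : M²) → flatten² x ≡ flatten² y → x ≈² y
flatten²-injective (a , b) (a′ , b′) eq =
  flatten-injective a a′ (++-injectiveˡ (flatten a) (flatten a′) eq) ,
  flatten-injective b b′ (++-injectiveʳ (flatten a) (flatten a′) eq)

flatten³-injective : (x y : M³) → flatten³ x ≡ flatten³ y → x ≈³ y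
flatten³-injective (x , yz) (x′ , yz′) eq =
  flatten-injective x x′ (++-injectiveˡ (flatten x) (flatten x′) eq) ,
  flatten²-injective yz yz′ (++-injectiveʳ (flatten x) (flatten x′) eq)

-- Computing with the expanded coefficients rather than with Bσ and Bτ keeps the
-- certificate checks below fast.
Bσ-coefficients Bτ-coefficients : Vec F3 9
Bσ-coefficients = 1# ∷ 2# ∷ 1# ∷ 2# ∷ 2# ∷ 2# ∷ 1# ∷ 2# ∷ 0# ∷ []
Bτ-coefficients = 1# ∷ 1# ∷ 2# ∷ 1# ∷ 2# ∷ 0# ∷ 2# ∷ 0# ∷ 1# ∷ []

Bσ-expansion : unflatten Bσ-coefficients ≈ Bσ
Bσ-expansion = flatten-injective (unflatten Bσ-coefficients) Bσ refl

Bτ-expansion : unflatten Bτ-coefficients ≈ Bτ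
Bτ-expansion = flatten-injective (unflatten Bτ-coefficients) Bτ refl

Mᶠ : ℕ → Set
Mᶠ n = Grid (Form n)

infixl 6 _+ᶠ_ _-ᶠ_ _+ᶠ²_
infixl 7 _*ᶠ_ _·ᶠ_

_+ᶠ_ _-ᶠ_ : Mᶠ n → Mᶠ n → Mᶠ n
(s +ᶠ t) i j = s i j ⊕ t i j
(s -ᶠ t) i j = s i j ⊝ t i j

sum3ᶠ : (Fin 3 → Form n) → Form n
sum3ᶠ g = g 0F ⊕ g 1F ⊕ g 2F

_*ᶠ_ : M → Mᶠ n → Mᶠ n
(x *ᶠ s) i j = sum3ᶠ λ k → sum3ᶠ λ l → x k l ⊛ s (i ⊖ k) (j ⊖ l)

_·ᶠ_ : Form n → M → Mᶠ n
(u ·ᶠ x) i j = x i j ⊛ u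

𝟘ᶠ : Mᶠ n
𝟘ᶠ i j = 0ᶠ

_+ᶠ²_ : Mᶠ n × Mᶠ n → Mᶠ n × Mᶠ n → Mᶠ n × Mᶠ n
(s , t) +ᶠ² (s′ , t′) = s +ᶠ s′ , t +ᶠ t′

σᶠ τᶠ 1-σᶠ 1-τᶠ Nσᶠ Nτᶠ : Mᶠ n → Mᶠ n
σᶠ s = unflatten Bσ-coefficients *ᶠ s
τᶠ s = unflatten Bτ-coefficients *ᶠ s
1-σᶠ s = s -ᶠ σᶠ s
1-τᶠ s = s -ᶠ τᶠ s
Nσᶠ s = s +ᶠ σᶠ s +ᶠ σᶠ (σᶠ s)
Nτᶠ s = s +ᶠ τᶠ s +ᶠ τᶠ (τᶠ s)

d⁰ᶠ : Mᶠ n → Mᶠ n × Mᶠ n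
d⁰ᶠ s = 1-σᶠ s , 1-τᶠ s

d¹ᶠ : Mᶠ n × Mᶠ n → Mᶠ n × Mᶠ n × Mᶠ n
d¹ᶠ (s , t) = Nσᶠ s , (1-τᶠ s -ᶠ 1-σᶠ t) , Nτᶠ t

-- combo c unfolds definitionally to partialCombo c 9 id.
partialCombo : (Fin 9 → F3) → (n : ℕ) → (Fin n → Fin 9) → M²
partialCombo c zero    ι = 𝟘²
partialCombo c (suc n) ι = (c (ι zero) ·² basis (ι zero)) +² partialCombo c n (ι ∘ suc)

partialComboᶠ : (Fin 9 → Form k) → (n : ℕ) → (Fin n → Fin 9) → Mᶠ k × Mᶠ k
partialComboᶠ C zero    ι = 𝟘ᶠ , 𝟘ᶠ
partialComboᶠ C (suc n) ι =
  (C (ι zero) ·ᶠ proj₁ (basis (ι zero)) , C (ι zero) ·ᶠ proj₂ (basis (ι zero))) +ᶠ² partialComboᶠ C n (ι ∘ suc)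

comboᶠ : (Fin 9 → Form n) → Mᶠ n × Mᶠ n
comboᶠ C = partialComboᶠ C 9 id

genericAt : (Fin 9 → Fin n) → Mᶠ n
genericAt ι i j = var (ι (combine i j))

module Denotation (ρ : Vec F3 n) where

  infix 4 _⊨_ _⊨²_ _⊨³_

  record _⊨_ (s : Mᶠ n) (x : M) : Set where
    constructor denotes
    field pointwise : ∀ i j → ⟦ s i j ⟧ ρ ≡ x i j
  open _⊨_

  _⊨²_ : Mᶠ n × Mᶠ n → M² → Set
  s ⊨² x = proj₁ s ⊨ proj₁ x × proj₂ s ⊨ proj₂ x

  _⊨³_ : Mᶠ n × Mᶠ n × Mᶠ n → M³ → Set
  s ⊨³ x = proj₁ s ⊨ proj₁ x × proj₂ s ⊨² proj₂ x

  ⊨-+ : ∀ {s t x y} → s ⊨ x → t ⊨ y → s +ᶠ t ⊨ x + y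
  ⊨-+ {s} {t} hs ht = denotes λ i j →
    trans (⟦⟧-⊕ (s i j) (t i j) ρ) (cong₂ _+₃_ (pointwise hs i j) (pointwise ht i j))

  ⊨-- : ∀ {s t x y} → s ⊨ x → t ⊨ y → s -ᶠ t ⊨ x - y
  ⊨-- {s} {t} hs ht = denotes λ i j →
    trans (⟦⟧-⊝ (s i j) (t i j) ρ) (cong₂ _-₃_ (pointwise hs i j) (pointwise ht i j))

  ⊨-· : ∀ {u c} (x : M) → ⟦ u ⟧ ρ ≡ c → u ·ᶠ x ⊨ c · x
  ⊨-· {u} {c} x ⟦u⟧≡c = denotes λ i j →
    trans (⟦⟧-⊛ (x i j) u ρ) (trans (cong (x i j *₃_) ⟦u⟧≡c) (*-comm (x i j) c))

  ⟦⟧-sum3ᶠ : (g : Fin 3 → Form n) → ⟦ sum3ᶠ g ⟧ ρ ≡ sum3 (λ k → ⟦ g k ⟧ ρ)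
  ⟦⟧-sum3ᶠ g = trans (⟦⟧-⊕ (g 0F ⊕ g 1F) (g 2F) ρ) (cong (_+₃ ⟦ g 2F ⟧ ρ) (⟦⟧-⊕ (g 0F) (g 1F) ρ))

  ⊨-* : ∀ {x′ x s y} → x′ ≈ x → s ⊨ y → x′ *ᶠ s ⊨ x * y
  ⊨-* {x′} {x} {s} {y} x′≈x hs = denotes convolution
    where
    sum3-cong : {g h : Fin 3 → F3} → (∀ k → g k ≡ h k) → sum3 g ≡ sum3 h
    sum3-cong g≡h = cong₂ _+₃_ (cong₂ _+₃_ (g≡h 0F) (g≡h 1F)) (g≡h 2F)
    convolution : ∀ i j → ⟦ (x′ *ᶠ s) i j ⟧ ρ ≡ (x * y) i j
    convolution i j = begin
      ⟦ (x′ *ᶠ s) i j ⟧ ρ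
        ≡⟨ ⟦⟧-sum3ᶠ (λ k → sum3ᶠ λ l → x′ k l ⊛ s (i ⊖ k) (j ⊖ l)) ⟩
      sum3 (λ k → ⟦ sum3ᶠ (λ l → x′ k l ⊛ s (i ⊖ k) (j ⊖ l)) ⟧ ρ)
        ≡⟨ sum3-cong (λ k → ⟦⟧-sum3ᶠ λ l → x′ k l ⊛ s (i ⊖ k) (j ⊖ l)) ⟩
      sum3 (λ k → sum3 λ l → ⟦ x′ k l ⊛ s (i ⊖ k) (j ⊖ l) ⟧ ρ)
        ≡⟨ sum3-cong (λ k → sum3-cong λ l → term k l) ⟩
      (x * y) i j
        ∎
      where
      term : ∀ k l → ⟦ x′ k l ⊛ s (i ⊖ k) (j ⊖ l) ⟧ ρ ≡ x k l *₃ y (i ⊖ k) (j ⊖ l)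
      term k l = trans (⟦⟧-⊛ (x′ k l) (s (i ⊖ k) (j ⊖ l)) ρ)
                       (cong₂ _*₃_ (x′≈x k l) (pointwise hs (i ⊖ k) (j ⊖ l)))

  ⊨-σ : ∀ {s x} → s ⊨ x → σᶠ s ⊨ σ· x
  ⊨-σ = ⊨-* Bσ-expansion

  ⊨-τ : ∀ {s x} → s ⊨ x → τᶠ s ⊨ τ· x
  ⊨-τ = ⊨-* Bτ-expansion

  ⊨-+² : ∀ {s t x y} → s ⊨² x → t ⊨² y → s +ᶠ² t ⊨² x +² y
  ⊨-+² (hs₁ , hs₂) (ht₁ , ht₂) = ⊨-+ hs₁ ht₁ , ⊨-+ hs₂ ht₂

  ⊨-d⁰ : ∀ {s x} → s ⊨ x → d⁰ᶠ s ⊨² d⁰ x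
  ⊨-d⁰ h = ⊨-- h (⊨-σ h) , ⊨-- h (⊨-τ h)

  ⊨-d¹ : ∀ {s x} → s ⊨² x → d¹ᶠ s ⊨³ d¹ x
  ⊨-d¹ (ha , hb) =
    ⊨-+ (⊨-+ ha (⊨-σ ha)) (⊨-σ (⊨-σ ha)) ,
    ⊨-- (⊨-- ha (⊨-τ ha)) (⊨-- hb (⊨-σ hb)) ,
    ⊨-+ (⊨-+ hb (⊨-τ hb)) (⊨-τ (⊨-τ hb))

  ⊨-combo : ∀ C {c} → (∀ k → ⟦ C k ⟧ ρ ≡ c k) → comboᶠ C ⊨² combo c
  ⊨-combo C {c} ⟦C⟧≡c = go 9 id
    where
    go : ∀ m ι → partialComboᶠ C m ι ⊨² partialCombo c m ι
    go zero    ι = denotes (λ _ _ → ⟦⟧-0ᶠ ρ) , denotes (λ _ _ → ⟦⟧-0ᶠ ρ)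
    go (suc m) ι = ⊨-+² (⊨-· _ (⟦C⟧≡c (ι zero)) , ⊨-· _ (⟦C⟧≡c (ι zero))) (go m (ι ∘ suc))

  ⊨-genericAt : ∀ ι {x} → (∀ i j → lookup ρ (ι (combine i j)) ≡ x i j) → genericAt ι ⊨ x
  ⊨-genericAt ι h = denotes λ i j → trans (⟦⟧-var (ι (combine i j)) ρ) (h i j)

  ⊨-flatten : ∀ {s x} → s ⊨ x → ⟦ flatten s ⟧* ρ ≡ flatten x
  ⊨-flatten {s} h = trans (sym (tabulate-∘ (⟦_⟧ ρ) (uncurry s ∘ remQuot 3)))
                          (tabulate-cong λ v → pointwise h (proj₁ (remQuot {3} 3 v)) (proj₂ (remQuot {3} 3 v)))

  ⊨²-flatten² : ∀ {s x} → s ⊨² x → ⟦ flatten² s ⟧* ρ ≡ flatten² x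
  ⊨²-flatten² {s} (ha , hb) =
    trans (map-++ (⟦_⟧ ρ) (flatten (proj₁ s)) (flatten (proj₂ s))) (cong₂ _++_ (⊨-flatten ha) (⊨-flatten hb))

  ⊨³-flatten³ : ∀ {s x} → s ⊨³ x → ⟦ flatten³ s ⟧* ρ ≡ flatten³ x
  ⊨³-flatten³ {s} (h , h²) =
    trans (map-++ (⟦_⟧ ρ) (flatten (proj₁ s)) (flatten² (proj₂ s))) (cong₂ _++_ (⊨-flatten h) (⊨²-flatten² h²))

-- φ, ψ and P, found by Gaussian elimination over F₃; only the identities checked below
-- matter.  A form in 18 indeterminates acts on x ∈ M² through flatten² x.
coordinateForms : Vec (Form 18) 9
coordinateForms =
  (1# ∷ 1# ∷ 1# ∷ 0# ∷ 0# ∷ 0# ∷ 0# ∷ 0# ∷ 0# ∷ 0# ∷ 0# ∷ 0# ∷ 0# ∷ 0# ∷ 0# ∷ 0# ∷ 0# ∷ 0# ∷ [])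
  ∷ (0# ∷ 0# ∷ 0# ∷ 1# ∷ 1# ∷ 1# ∷ 0# ∷ 0# ∷ 0# ∷ 0# ∷ 0# ∷ 0# ∷ 0# ∷ 0# ∷ 0# ∷ 0# ∷ 0# ∷ 0# ∷ [])
  ∷ (2# ∷ 1# ∷ 1# ∷ 1# ∷ 0# ∷ 0# ∷ 1# ∷ 0# ∷ 0# ∷ 0# ∷ 0# ∷ 0# ∷ 0# ∷ 0# ∷ 0# ∷ 0# ∷ 0# ∷ 0# ∷ [])
  ∷ (1# ∷ 0# ∷ 2# ∷ 0# ∷ 2# ∷ 1# ∷ 2# ∷ 1# ∷ 0# ∷ 0# ∷ 0# ∷ 0# ∷ 0# ∷ 0# ∷ 0# ∷ 0# ∷ 0# ∷ 0# ∷ [])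
  ∷ (0# ∷ 1# ∷ 0# ∷ 1# ∷ 1# ∷ 0# ∷ 0# ∷ 0# ∷ 0# ∷ 1# ∷ 0# ∷ 0# ∷ 0# ∷ 0# ∷ 0# ∷ 0# ∷ 0# ∷ 0# ∷ [])
  ∷ (2# ∷ 2# ∷ 0# ∷ 2# ∷ 0# ∷ 0# ∷ 0# ∷ 0# ∷ 0# ∷ 0# ∷ 1# ∷ 0# ∷ 0# ∷ 0# ∷ 0# ∷ 0# ∷ 0# ∷ 0# ∷ [])
  ∷ (1# ∷ 0# ∷ 0# ∷ 0# ∷ 2# ∷ 0# ∷ 0# ∷ 0# ∷ 0# ∷ 0# ∷ 0# ∷ 1# ∷ 0# ∷ 0# ∷ 0# ∷ 0# ∷ 0# ∷ 0# ∷ [])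
  ∷ (2# ∷ 2# ∷ 0# ∷ 2# ∷ 0# ∷ 0# ∷ 0# ∷ 0# ∷ 0# ∷ 0# ∷ 0# ∷ 0# ∷ 1# ∷ 0# ∷ 0# ∷ 0# ∷ 0# ∷ 0# ∷ [])
  ∷ (1# ∷ 0# ∷ 0# ∷ 0# ∷ 2# ∷ 0# ∷ 0# ∷ 0# ∷ 0# ∷ 0# ∷ 0# ∷ 0# ∷ 0# ∷ 0# ∷ 0# ∷ 1# ∷ 0# ∷ 0# ∷ [])
  ∷ []

primitiveForms : Vec (Form 18) 9
primitiveForms =
  (2# ∷ 2# ∷ 0# ∷ 2# ∷ 1# ∷ 1# ∷ 0# ∷ 1# ∷ 2# ∷ 0# ∷ 2# ∷ 1# ∷ 0# ∷ 0# ∷ 0# ∷ 0# ∷ 1# ∷ 2# ∷ [])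
  ∷ (2# ∷ 1# ∷ 2# ∷ 2# ∷ 2# ∷ 1# ∷ 2# ∷ 1# ∷ 0# ∷ 0# ∷ 1# ∷ 2# ∷ 0# ∷ 0# ∷ 0# ∷ 0# ∷ 2# ∷ 1# ∷ [])
  ∷ (0# ∷ 0# ∷ 0# ∷ 0# ∷ 0# ∷ 0# ∷ 0# ∷ 0# ∷ 0# ∷ 0# ∷ 0# ∷ 0# ∷ 0# ∷ 0# ∷ 0# ∷ 0# ∷ 0# ∷ 0# ∷ [])
  ∷ (1# ∷ 1# ∷ 1# ∷ 0# ∷ 1# ∷ 0# ∷ 1# ∷ 0# ∷ 2# ∷ 2# ∷ 0# ∷ 1# ∷ 0# ∷ 0# ∷ 0# ∷ 1# ∷ 0# ∷ 2# ∷ [])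
  ∷ (2# ∷ 0# ∷ 1# ∷ 0# ∷ 2# ∷ 0# ∷ 1# ∷ 0# ∷ 2# ∷ 1# ∷ 2# ∷ 0# ∷ 0# ∷ 0# ∷ 0# ∷ 2# ∷ 1# ∷ 0# ∷ [])
  ∷ (0# ∷ 0# ∷ 0# ∷ 0# ∷ 0# ∷ 0# ∷ 0# ∷ 0# ∷ 0# ∷ 0# ∷ 0# ∷ 0# ∷ 0# ∷ 0# ∷ 0# ∷ 0# ∷ 0# ∷ 0# ∷ [])
  ∷ (0# ∷ 0# ∷ 0# ∷ 0# ∷ 0# ∷ 0# ∷ 0# ∷ 0# ∷ 0# ∷ 0# ∷ 0# ∷ 0# ∷ 0# ∷ 0# ∷ 0# ∷ 0# ∷ 0# ∷ 0# ∷ [])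
  ∷ (0# ∷ 0# ∷ 0# ∷ 0# ∷ 0# ∷ 0# ∷ 0# ∷ 0# ∷ 0# ∷ 0# ∷ 0# ∷ 0# ∷ 0# ∷ 0# ∷ 0# ∷ 0# ∷ 0# ∷ 0# ∷ [])
  ∷ (0# ∷ 0# ∷ 0# ∷ 0# ∷ 0# ∷ 0# ∷ 0# ∷ 0# ∷ 0# ∷ 0# ∷ 0# ∷ 0# ∷ 0# ∷ 0# ∷ 0# ∷ 0# ∷ 0# ∷ 0# ∷ [])
  ∷ []

homotopyMatrix : Vec (Form 27) 18
homotopyMatrix =
  (0# ∷ 0# ∷ 0# ∷ 0# ∷ 0# ∷ 0# ∷ 0# ∷ 0# ∷ 0# ∷ 0# ∷ 2# ∷ 0# ∷ 1# ∷ 1# ∷ 0# ∷ 0# ∷ 0# ∷ 0# ∷ 0# ∷ 0# ∷ 0# ∷ 0# ∷ 0# ∷ 0# ∷ 0# ∷ 0# ∷ 0# ∷ [])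
  ∷ (1# ∷ 0# ∷ 0# ∷ 0# ∷ 0# ∷ 0# ∷ 0# ∷ 0# ∷ 0# ∷ 1# ∷ 0# ∷ 0# ∷ 0# ∷ 1# ∷ 0# ∷ 0# ∷ 0# ∷ 0# ∷ 0# ∷ 0# ∷ 0# ∷ 0# ∷ 0# ∷ 0# ∷ 0# ∷ 0# ∷ 0# ∷ [])
  ∷ (2# ∷ 0# ∷ 0# ∷ 0# ∷ 0# ∷ 0# ∷ 0# ∷ 0# ∷ 0# ∷ 2# ∷ 1# ∷ 0# ∷ 2# ∷ 1# ∷ 0# ∷ 0# ∷ 0# ∷ 0# ∷ 0# ∷ 0# ∷ 0# ∷ 0# ∷ 0# ∷ 0# ∷ 0# ∷ 0# ∷ 0# ∷ [])
  ∷ (2# ∷ 0# ∷ 0# ∷ 0# ∷ 0# ∷ 0# ∷ 0# ∷ 0# ∷ 0# ∷ 0# ∷ 1# ∷ 0# ∷ 2# ∷ 2# ∷ 0# ∷ 0# ∷ 0# ∷ 0# ∷ 0# ∷ 0# ∷ 0# ∷ 0# ∷ 0# ∷ 0# ∷ 0# ∷ 0# ∷ 0# ∷ [])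
  ∷ (2# ∷ 0# ∷ 0# ∷ 0# ∷ 0# ∷ 0# ∷ 0# ∷ 0# ∷ 0# ∷ 2# ∷ 0# ∷ 0# ∷ 0# ∷ 2# ∷ 0# ∷ 0# ∷ 0# ∷ 0# ∷ 0# ∷ 0# ∷ 0# ∷ 0# ∷ 0# ∷ 0# ∷ 0# ∷ 0# ∷ 0# ∷ [])
  ∷ (2# ∷ 0# ∷ 0# ∷ 0# ∷ 0# ∷ 0# ∷ 0# ∷ 0# ∷ 0# ∷ 1# ∷ 2# ∷ 0# ∷ 1# ∷ 2# ∷ 0# ∷ 0# ∷ 0# ∷ 0# ∷ 0# ∷ 0# ∷ 0# ∷ 0# ∷ 0# ∷ 0# ∷ 0# ∷ 0# ∷ 0# ∷ [])
  ∷ (1# ∷ 0# ∷ 0# ∷ 0# ∷ 0# ∷ 0# ∷ 0# ∷ 0# ∷ 0# ∷ 0# ∷ 0# ∷ 0# ∷ 0# ∷ 0# ∷ 0# ∷ 0# ∷ 0# ∷ 0# ∷ 0# ∷ 0# ∷ 0# ∷ 0# ∷ 0# ∷ 0# ∷ 0# ∷ 0# ∷ 0# ∷ [])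
  ∷ (0# ∷ 0# ∷ 0# ∷ 0# ∷ 0# ∷ 0# ∷ 0# ∷ 0# ∷ 0# ∷ 0# ∷ 0# ∷ 0# ∷ 0# ∷ 0# ∷ 0# ∷ 0# ∷ 0# ∷ 0# ∷ 0# ∷ 0# ∷ 0# ∷ 0# ∷ 0# ∷ 0# ∷ 0# ∷ 0# ∷ 0# ∷ [])
  ∷ (0# ∷ 0# ∷ 0# ∷ 0# ∷ 0# ∷ 0# ∷ 0# ∷ 0# ∷ 0# ∷ 0# ∷ 0# ∷ 0# ∷ 0# ∷ 0# ∷ 0# ∷ 0# ∷ 0# ∷ 0# ∷ 0# ∷ 0# ∷ 0# ∷ 0# ∷ 0# ∷ 0# ∷ 0# ∷ 0# ∷ 0# ∷ [])
  ∷ (1# ∷ 0# ∷ 0# ∷ 0# ∷ 0# ∷ 0# ∷ 0# ∷ 0# ∷ 0# ∷ 0# ∷ 2# ∷ 0# ∷ 1# ∷ 1# ∷ 0# ∷ 0# ∷ 0# ∷ 0# ∷ 0# ∷ 0# ∷ 0# ∷ 0# ∷ 0# ∷ 0# ∷ 0# ∷ 0# ∷ 0# ∷ [])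
  ∷ (0# ∷ 0# ∷ 0# ∷ 0# ∷ 0# ∷ 0# ∷ 0# ∷ 0# ∷ 0# ∷ 1# ∷ 0# ∷ 0# ∷ 0# ∷ 1# ∷ 0# ∷ 0# ∷ 0# ∷ 0# ∷ 0# ∷ 0# ∷ 0# ∷ 0# ∷ 0# ∷ 0# ∷ 0# ∷ 0# ∷ 0# ∷ [])
  ∷ (2# ∷ 0# ∷ 0# ∷ 0# ∷ 0# ∷ 0# ∷ 0# ∷ 0# ∷ 0# ∷ 2# ∷ 1# ∷ 0# ∷ 2# ∷ 1# ∷ 0# ∷ 0# ∷ 0# ∷ 0# ∷ 0# ∷ 0# ∷ 0# ∷ 0# ∷ 0# ∷ 0# ∷ 0# ∷ 0# ∷ 0# ∷ [])
  ∷ (0# ∷ 0# ∷ 0# ∷ 0# ∷ 0# ∷ 0# ∷ 0# ∷ 0# ∷ 0# ∷ 1# ∷ 0# ∷ 0# ∷ 0# ∷ 1# ∷ 0# ∷ 0# ∷ 0# ∷ 0# ∷ 0# ∷ 0# ∷ 0# ∷ 0# ∷ 0# ∷ 0# ∷ 0# ∷ 0# ∷ 0# ∷ [])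
  ∷ (1# ∷ 0# ∷ 0# ∷ 0# ∷ 0# ∷ 0# ∷ 0# ∷ 0# ∷ 0# ∷ 1# ∷ 0# ∷ 0# ∷ 1# ∷ 2# ∷ 0# ∷ 0# ∷ 0# ∷ 0# ∷ 0# ∷ 0# ∷ 0# ∷ 0# ∷ 0# ∷ 0# ∷ 0# ∷ 0# ∷ 0# ∷ [])
  ∷ (0# ∷ 0# ∷ 0# ∷ 0# ∷ 0# ∷ 0# ∷ 0# ∷ 0# ∷ 0# ∷ 0# ∷ 1# ∷ 0# ∷ 2# ∷ 0# ∷ 0# ∷ 0# ∷ 0# ∷ 0# ∷ 0# ∷ 0# ∷ 0# ∷ 0# ∷ 0# ∷ 0# ∷ 0# ∷ 0# ∷ 0# ∷ [])
  ∷ (2# ∷ 0# ∷ 0# ∷ 0# ∷ 0# ∷ 0# ∷ 0# ∷ 0# ∷ 0# ∷ 2# ∷ 1# ∷ 0# ∷ 2# ∷ 1# ∷ 0# ∷ 0# ∷ 0# ∷ 0# ∷ 0# ∷ 0# ∷ 0# ∷ 0# ∷ 0# ∷ 0# ∷ 0# ∷ 0# ∷ 0# ∷ [])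
  ∷ (0# ∷ 0# ∷ 0# ∷ 0# ∷ 0# ∷ 0# ∷ 0# ∷ 0# ∷ 0# ∷ 0# ∷ 0# ∷ 0# ∷ 0# ∷ 0# ∷ 0# ∷ 0# ∷ 0# ∷ 0# ∷ 0# ∷ 0# ∷ 0# ∷ 0# ∷ 0# ∷ 0# ∷ 0# ∷ 0# ∷ 0# ∷ [])
  ∷ (0# ∷ 0# ∷ 0# ∷ 0# ∷ 0# ∷ 0# ∷ 0# ∷ 0# ∷ 0# ∷ 0# ∷ 0# ∷ 0# ∷ 0# ∷ 0# ∷ 0# ∷ 0# ∷ 0# ∷ 0# ∷ 0# ∷ 0# ∷ 0# ∷ 0# ∷ 0# ∷ 0# ∷ 0# ∷ 0# ∷ 0# ∷ [])
  ∷ []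

coordinateForms-dual : coordinateForms ∙ flatten² (comboᶠ var) ≡ tabulate var
coordinateForms-dual = refl

coordinateForms-d⁰ : coordinateForms ∙ flatten² (d⁰ᶠ (genericAt id)) ≡ replicate 9 0ᶠ
coordinateForms-d⁰ = refl

generic² : Mᶠ 18 × Mᶠ 18
generic² = genericAt (_↑ˡ 9) , genericAt (9 ↑ʳ_)

genericSplitting : Mᶠ 18 × Mᶠ 18
genericSplitting = comboᶠ (lookup coordinateForms) +ᶠ² d⁰ᶠ (unflatten primitiveForms)

genericCoboundary : Vec (Form 18) 27
genericCoboundary = flatten³ (d¹ᶠ generic²)

contractingHomotopy : flatten² generic² ≡ flatten² genericSplitting ⊞ homotopyMatrix ∙ genericCoboundary
contractingHomotopy = refl

coordinates : M² → Fin 9 → F3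
coordinates x = lookup (⟦ coordinateForms ⟧* flatten² x)

primitiveCochain : M² → M
primitiveCochain x = unflatten (⟦ primitiveForms ⟧* flatten² x)

coordinates-combo : (c : Fin 9 → F3) → ⟦ coordinateForms ⟧* flatten² (combo c) ≡ tabulate c
coordinates-combo c = begin
  ⟦ coordinateForms ⟧* flatten² (combo c)
    ≡⟨ cong (⟦ coordinateForms ⟧*_) (sym (⊨²-flatten² {comboᶠ var} {combo c} (⊨-combo var ⟦var⟧))) ⟩
  ⟦ coordinateForms ⟧* (⟦ flatten² (comboᶠ var) ⟧* ρ)
    ≡⟨ sym (⟦⟧*-∙ coordinateForms (flatten² (comboᶠ var)) ρ) ⟩
  ⟦ coordinateForms ∙ flatten² (comboᶠ var) ⟧* ρ
    ≡⟨ cong (λ P → ⟦ P ⟧* ρ) {coordinateForms ∙ flatten² (comboᶠ var)} {tabulate var} coordinateForms-dual ⟩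
  ⟦ tabulate var ⟧* ρ
    ≡⟨ ⟦⟧*-identity ρ ⟩
  tabulate c
    ∎
  where
  ρ : Vec F3 9
  ρ = tabulate c
  open Denotation ρ
  ⟦var⟧ : ∀ k → ⟦ var k ⟧ ρ ≡ c k
  ⟦var⟧ k = trans (⟦⟧-var k ρ) (lookup∘tabulate c k)

coordinates-d⁰ : (m : M) → ⟦ coordinateForms ⟧* flatten² (d⁰ m) ≡ 0ᶠ
coordinates-d⁰ m = begin
  ⟦ coordinateForms ⟧* flatten² (d⁰ m)
    ≡⟨ cong (⟦ coordinateForms ⟧*_) (sym (⊨²-flatten² {d⁰ᶠ (genericAt id)} {d⁰ m} (⊨-d⁰ generic⊨m))) ⟩
  ⟦ coordinateForms ⟧* (⟦ flatten² (d⁰ᶠ (genericAt id)) ⟧* ρ)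
    ≡⟨ sym (⟦⟧*-∙ coordinateForms (flatten² (d⁰ᶠ (genericAt id))) ρ) ⟩
  ⟦ coordinateForms ∙ flatten² (d⁰ᶠ (genericAt id)) ⟧* ρ
    ≡⟨ cong (λ P → ⟦ P ⟧* ρ) {coordinateForms ∙ flatten² (d⁰ᶠ (genericAt id))} {replicate 9 0ᶠ} coordinateForms-d⁰ ⟩
  ⟦ replicate 9 0ᶠ ⟧* ρ
    ≡⟨ ⟦⟧*-replicate-0ᶠ ρ ⟩
  0ᶠ
    ∎
  where
  ρ : Vec F3 9
  ρ = flatten m
  open Denotation ρ
  generic⊨m : genericAt id ⊨ m
  generic⊨m = ⊨-genericAt id (lookup-flatten m)

homotopy-formula : (x : M²) →
  flatten² x ≡ flatten² (combo (coordinates x) +² d⁰ (primitiveCochain x)) ⊕ ⟦ homotopyMatrix ⟧* flatten³ (d¹ x)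
homotopy-formula x@(a , b) = begin
  flatten² x
    ≡⟨ sym (⊨²-flatten² {generic²} {x} generic⊨x) ⟩
  ⟦ flatten² generic² ⟧* ρ
    ≡⟨ cong (λ P → ⟦ P ⟧* ρ) {flatten² generic²} {flatten² genericSplitting ⊞ homotopyMatrix ∙ genericCoboundary}
            contractingHomotopy ⟩
  ⟦ flatten² genericSplitting ⊞ homotopyMatrix ∙ genericCoboundary ⟧* ρ
    ≡⟨ ⟦⟧*-⊞ (flatten² genericSplitting) (homotopyMatrix ∙ genericCoboundary) ρ ⟩
  ⟦ flatten² genericSplitting ⟧* ρ ⊕ ⟦ homotopyMatrix ∙ genericCoboundary ⟧* ρ
    ≡⟨ cong₂ _⊕_ (⊨²-flatten² {genericSplitting} {y} splitting⊨y) (⟦⟧*-∙ homotopyMatrix genericCoboundary ρ) ⟩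
  flatten² y ⊕ ⟦ homotopyMatrix ⟧* (⟦ genericCoboundary ⟧* ρ)
    ≡⟨ cong (λ v → flatten² y ⊕ ⟦ homotopyMatrix ⟧* v) (⊨³-flatten³ {d¹ᶠ generic²} {d¹ x} (⊨-d¹ generic⊨x)) ⟩
  flatten² y ⊕ ⟦ homotopyMatrix ⟧* flatten³ (d¹ x)
    ∎
  where
  ρ : Vec F3 18
  ρ = flatten² x
  open Denotation ρ
  y : M²
  y = combo (coordinates x) +² d⁰ (primitiveCochain x)
  generic⊨x : generic² ⊨² x
  generic⊨x =
    ⊨-genericAt (_↑ˡ 9) (λ i j → trans (lookup-++ˡ (flatten a) (flatten b) (combine i j)) (lookup-flatten a i j)) ,
    ⊨-genericAt (9 ↑ʳ_) (λ i j → trans (lookup-++ʳ (flatten a) (flatten b) (combine i j)) (lookup-flatten b i j))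
  primitive⊨ : unflatten primitiveForms ⊨ primitiveCochain x
  primitive⊨ = denotes λ i j → sym (lookup-map (combine i j) (⟦_⟧ ρ) primitiveForms)
  splitting⊨y : genericSplitting ⊨² y
  splitting⊨y = ⊨-+² (⊨-combo (lookup coordinateForms) (λ k → sym (lookup-map k (⟦_⟧ ρ) coordinateForms)))
                     (⊨-d⁰ primitive⊨)

flatten³-d¹-basis : (k : Fin 9) → flatten³ (d¹ (basis k)) ≡ 0ᶠ
flatten³-d¹-basis 0F = refl
flatten³-d¹-basis 1F = refl
flatten³-d¹-basis 2F = refl
flatten³-d¹-basis 3F = refl
flatten³-d¹-basis 4F = refl
flatten³-d¹-basis 5F = refl
flatten³-d¹-basis 6F = refl
flatten³-d¹-basis 7F = refl
flatten³-d¹-basis 8F = refl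

basis-cocycle : (k : Fin 9) → d¹ (basis k) ≈³ 𝟘³
basis-cocycle k = flatten³-injective (d¹ (basis k)) 𝟘³ (flatten³-d¹-basis k)

basis-independent : (c : Fin 9 → F3) (m : M) → combo c ≈² d⁰ m → (k : Fin 9) → c k ≡ 0#
basis-independent c m combo≈d⁰ k = begin
  c k
    ≡⟨ sym (lookup∘tabulate c k) ⟩
  lookup (tabulate c) k
    ≡⟨ cong (λ v → lookup v k) (sym (coordinates-combo c)) ⟩
  lookup (⟦ coordinateForms ⟧* flatten² (combo c)) k
    ≡⟨ cong (λ v → lookup (⟦ coordinateForms ⟧* v) k) (flatten²-cong (combo c) (d⁰ m) combo≈d⁰) ⟩
  lookup (⟦ coordinateForms ⟧* flatten² (d⁰ m)) k
    ≡⟨ cong (λ v → lookup v k) (coordinates-d⁰ m) ⟩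
  lookup 0ᶠ k
    ≡⟨ lookup-replicate k 0# ⟩
  0#
    ∎

cocycle-decomposition : (x : M²) → d¹ x ≈³ 𝟘³ → Σ (Fin 9 → F3) (λ c → Σ M (λ m → x ≈² (combo c +² d⁰ m)))
cocycle-decomposition x cocycle = coordinates x , primitiveCochain x , flatten²-injective x y (begin
  flatten² x
    ≡⟨ homotopy-formula x ⟩
  flatten² y ⊕ ⟦ homotopyMatrix ⟧* flatten³ (d¹ x)
    ≡⟨ cong (λ v → flatten² y ⊕ ⟦ homotopyMatrix ⟧* v) (flatten³-cong (d¹ x) 𝟘³ cocycle) ⟩
  flatten² y ⊕ ⟦ homotopyMatrix ⟧* 0ᶠ
    ≡⟨ cong (flatten² y ⊕_) (⟦⟧*-at-0ᶠ homotopyMatrix) ⟩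
  flatten² y ⊕ 0ᶠ
    ≡⟨ ⊕-identityʳ (flatten² y) ⟩
  flatten² y
    ∎)
  where
  y : M²
  y = combo (coordinates x) +² d⁰ (primitiveCochain x)

proposition7p5 : ((k : Fin 9) → d¹ (basis k) ≈³ 𝟘³)
    × ((c : Fin 9 → F3) → (m : M) → combo c ≈² d⁰ m → (k : Fin 9) → c k ≡ 0#)
    × ((x : M²) → d¹ x ≈³ 𝟘³ → Σ (Fin 9 → F3) (λ c → Σ M (λ m → x ≈² (combo c +² d⁰ m))))
proposition7p5 = basis-cocycle , basis-independent , cocycle-decomposition
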